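{- Let $n$ be a positive integer, $\perp\!\!\!\perp$ a pole, $t_1,\dots,t_n$ terms and $\pi$ a stack. Then $t_1\cdot\ldots\cdot t_n\cdot\pi\in\|\mathrm{N}_n\|_{\perp\!\!\!\perp}$ if and only if there is at most one $i\in\{1,\dots,n\}$ such that $t_i\star\pi\notin\perp\!\!\!\perp$.
   Context: $\lambda_c$-calculus. Fix a countably infinite set of variables. $\lambda_c$-terms: $t,u ::= x \mid tu \mid \lambda x.t \mid \mathrm{cc} \mid k_\pi$ ($\pi$ a stack) $\mid \kappa_m$ ($m\in\mathbb{N}$) $\mid \beta_m$ ($m\in\mathbb{N}$), modulo $\alpha$-equivalence. A term is a closed $\lambda_c$-term; $\Lambda$ the set of terms. Stacks: $\pi ::= \omega_m \mid t\cdot\pi$; $\Pi$ the set of stacks. Processes: $t\star\pi$. One-step evaluation $\succ_1$: $tu\star\pi \succ_1 t\star u\cdot\pi$, $\lambda x.t\star u\cdot\pi\succ_1 t[x:=u]\star\pi$, $\mathrm{cc}\star t\cdot\pi\succ_1 t\star k_\pi\cdot\pi$, $k_{\pi'}\star t\cdot\pi\succ_1 t\star\pi'$; $\succ$ its reflexive-transitive closure. A pole is a set $\perp\!\!\!\perp$ of processes with $p\succ q$, $q\in\perp\!\!\!\perp\Rightarrow p\in\perp\!\!\!\perp$. For the pole $\perp\!\!\!\perp$ and closed formulas built from $\top$, subsets $S\subseteq\Pi$ (used as constants), $\to$, $\cap$ and $\forall X$ ($X$ nullary): $\|\top\|=\emptyset$, $\|S\|=S$, $\|A\to B\|=\{t\cdot\pi:t\in|A|,\pi\in\|B\|\}$,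 $\|A\cap B\|=\|A\|\cup\|B\|$, $\|\forall X\,A\|=\bigcup_{S\subseteq\Pi}\|A[X:=S]\|$; $|A|=\{t\in\Lambda:\forall\pi\in\|A\|,\ t\star\pi\in\perp\!\!\!\perp\}$. $\mathrm{N}_n$ is $\forall X(B_1\cap\cdots\cap B_n)$, where $B_i$ is $C_{i,1}\to\cdots\to C_{i,n}\to X$ with $C_{i,i}=\top$ and $C_{i,k}=X$ for $k\ne i$. -}

module Defs where

open import Level using (Level; 0ℓ; Lift) renaming (suc to lsuc)
open import Data.Nat using (ℕ; zero; suc)
open import Data.Fin using (Fin; zero; suc; _≟_)
open import Data.Product using (Σ; _×_; _,_)
open import Data.Sum using (_⊎_)
open import Data.Empty using (⊥)
open import Relation.Nullary using (yes; no)
open import Relation.Unary using (Pred)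
open import Relation.Binary.PropositionalEquality using (_≡_)
open import Relation.Binary.Construct.Closure.ReflexiveTransitive using (Star)

-- λc-terms (de Bruijn, so α-equivalence is syntactic identity).
-- Tm n : terms with at most n free variables; closed terms are Tm 0.
-- Stacks contain closed terms only.

mutual
  data Tm (n : ℕ) : Set where
    var : Fin n → Tm n
    app : Tm n → Tm n → Tm n
    lam : Tm (suc n) → Tm n
    cc  : Tm n
    k   : Stack → Tm n
    κ   : ℕ → Tm n
    β   : ℕ → Tm n

  data Stack : Set where
    ω   : ℕ → Stack
    _·_ : Tm 0 → Stack → Stack

infixr 5 _·_

Term : Set
Term = Tm 0

ext : ∀ {n m} → (Fin n → Fin m) → Fin (suc n) → Fin (suc m)
ext ρ zero    = zero
ext ρ (suc i) = suc (ρ i)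

rename : ∀ {n m} → (Fin n → Fin m) → Tm n → Tm m
rename ρ (var i)   = var (ρ i)
rename ρ (app t u) = app (rename ρ t) (rename ρ u)
rename ρ (lam t)   = lam (rename (ext ρ) t)
rename ρ cc        = cc
rename ρ (k π)     = k π
rename ρ (κ m)     = κ m
rename ρ (β m)     = β m

exts : ∀ {n m} → (Fin n → Tm m) → Fin (suc n) → Tm (suc m)
exts σ zero    = var zero
exts σ (suc i) = rename suc (σ i)

subst : ∀ {n m} → (Fin n → Tm m) → Tm n → Tm m
subst σ (var i)   = σ i
subst σ (app t u) = app (subst σ t) (subst σ u)
subst σ (lam t)   = lam (subst (exts σ) t)
subst σ cc        = cc
subst σ (k π)     = k π
subst σ (κ m)     = κ m
subst σ (β m)     = β m

_[_] : ∀ {n} → Tm (suc n) → Tm n → Tm n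
t [ u ] = subst σ t
  where
  σ : Fin (suc _) → Tm _
  σ zero    = u
  σ (suc i) = var i

record Process : Set where
  constructor _⋆_
  field
    term  : Term
    stack : Stack

infix 4 _⋆_

data _≻₁_ : Process → Process → Set where
  push    : ∀ {t u π}   → (app t u ⋆ π) ≻₁ (t ⋆ u · π)
  grab    : ∀ {t u π}   → (lam t ⋆ u · π) ≻₁ (t [ u ] ⋆ π)
  save    : ∀ {t π}     → (cc ⋆ t · π) ≻₁ (t ⋆ k π · π)
  restore : ∀ {π' t π}  → (k π' ⋆ t · π) ≻₁ (t ⋆ π')

_≻_ : Process → Process → Set
_≻_ = Star _≻₁_

record Pole : Set₁ where
  field
    ⊥⊥     : Pred Process 0ℓ
    closed : ∀ {p q} → p ≻ q → ⊥⊥ q → ⊥⊥ p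

-- Formulas: ⊤, constants S ⊆ Π, →, ∩, ∀X (X nullary).
-- Second-order variables in de Bruijn form; Formula 0 = closed formulas.

data Formula (n : ℕ) : Set₁ where
  `⊤   : Formula n
  `var : Fin n → Formula n
  `S   : Pred Stack 0ℓ → Formula n
  _⇒_  : Formula n → Formula n → Formula n
  _∩_  : Formula n → Formula n → Formula n
  `∀   : Formula (suc n) → Formula n

infixr 6 _⇒_
infixr 7 _∩_

Env : ℕ → Set₁
Env n = Fin n → Pred Stack 0ℓ

_∷ₑ_ : ∀ {n} → Pred Stack 0ℓ → Env n → Env (suc n)
(S ∷ₑ ρ) zero    = S
(S ∷ₑ ρ) (suc i) = ρ i

module Realizability (P : Pole) where
  open Pole P

  -- falsity value ‖A‖ρ and truth value |A|ρ; the environment ρ records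
  -- the substitution A[X:=S] performed at ∀-nodes.
  mutual
    ‖_‖⟨_⟩ : ∀ {n} → Formula n → Env n → Pred Stack (lsuc 0ℓ)
    ‖ `⊤ ‖⟨ ρ ⟩ π      = Lift _ ⊥
    ‖ `var X ‖⟨ ρ ⟩ π  = Lift _ (ρ X π)
    ‖ `S S ‖⟨ ρ ⟩ π    = Lift _ (S π)
    ‖ A ⇒ B ‖⟨ ρ ⟩ π   = Σ Term λ t → Σ Stack λ π' →
                            (π ≡ t · π') × ∣ A ∣⟨ ρ ⟩ t × ‖ B ‖⟨ ρ ⟩ π'
    ‖ A ∩ B ‖⟨ ρ ⟩ π   = ‖ A ‖⟨ ρ ⟩ π ⊎ ‖ B ‖⟨ ρ ⟩ π
    ‖ `∀ A ‖⟨ ρ ⟩ π    = Σ (Pred Stack 0ℓ) λ S → ‖ A ‖⟨ S ∷ₑ ρ ⟩ π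

    ∣_∣⟨_⟩ : ∀ {n} → Formula n → Env n → Pred Term (lsuc 0ℓ)
    ∣ A ∣⟨ ρ ⟩ t = ∀ π → ‖ A ‖⟨ ρ ⟩ π → ⊥⊥ (t ⋆ π)

  ‖_‖ : Formula 0 → Pred Stack (lsuc 0ℓ)
  ‖ A ‖ = ‖ A ‖⟨ (λ ()) ⟩

  ∣_∣ : Formula 0 → Pred Term (lsuc 0ℓ)
  ∣ A ∣ = ∣ A ∣⟨ (λ ()) ⟩

-- N_n = ∀X (B_1 ∩ ... ∩ B_n),  B_i = C_{i,1} → ... → C_{i,n} → X,
-- C_{i,i} = ⊤, C_{i,k} = X (k ≠ i).

arrows : ∀ {n} (m : ℕ) → (Fin m → Formula n) → Formula n → Formula n
arrows zero    C B = B
arrows (suc m) C B = C zero ⇒ arrows m (λ j → C (suc j)) B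

-- B_1 ∩ ... ∩ B_m (right-nested); the m = 0 case is never used (n ≥ 1)
⋂ : ∀ {n} (m : ℕ) → (Fin m → Formula n) → Formula n
⋂ zero          F = `⊤
⋂ (suc zero)    F = F zero
⋂ (suc (suc m)) F = F zero ∩ ⋂ (suc m) (λ j → F (suc j))

C : (n : ℕ) → Fin n → Fin n → Formula 1
C n i j with i ≟ j
... | yes _ = `⊤
... | no  _ = `var zero

B : (n : ℕ) → Fin n → Formula 1
B n i = arrows n (C n i) (`var zero)

N : ℕ → Formula 0
N n = `∀ (⋂ n (B n))

pushAll : ∀ (n : ℕ) → (Fin n → Term) → Stack → Stack
pushAll zero    ts π = π
pushAll (suc n) ts π = ts zero · pushAll n (λ j → ts (suc j)) π

-- We first compute the falsity value of each building block of
-- Nₙ = ∀X (B₁ ∩ … ∩ Bₙ) on a stack of the shape t₁ · … · tₙ · π: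
--   * an iterated arrow D₁ → … → Dₘ → A is falsified by it exactly when each
--     tⱼ realizes Dⱼ and π falsifies A;
--   * a finite intersection is falsified exactly when some member is;
--   * Cᵢⱼ is realized by t when i = j, and otherwise exactly when t ⋆ σ is in
--     the pole for every σ ∈ X.
-- Together this says: the stack falsifies Bᵢ[X := S] iff π ∈ S and every tⱼ
-- with j ≠ i is orthogonal to S.  The "only if" direction then takes S and i
-- from the falsity witness and tests π ∈ S.  The "if" direction picks S = {π}
-- and an index i outside of which every tⱼ ⋆ π is in the pole; choosing such
-- an i is the one classical step (excluded middle), isolated in a general lemma.

module Submission where

open import Defs
open import Level using (0ℓ; lift; lower)
open import Axiom.ExcludedMiddle using (ExcludedMiddle)
open import Data.Nat using (ℕ; _≤_; zero; suc; s≤s)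
open import Data.Fin using (Fin; zero; suc; _≟_)
open import Data.Product using (_×_; Σ; _,_; proj₁; proj₂)
open import Data.Sum using (inj₁; inj₂)
open import Data.Empty using (⊥-elim)
open import Relation.Nullary using (¬_; yes; no)
open import Relation.Nullary.Decidable using (decidable-stable)
open import Relation.Unary using (Pred)
open import Relation.Binary.PropositionalEquality using (_≡_; _≢_; refl; sym; trans)

single-exception : ExcludedMiddle 0ℓ → {A : Set} (Q : A → Set) → A →
  (∀ x y → ¬ Q x → ¬ Q y → x ≡ y) →
  Σ A λ i → ∀ q → i ≢ q → Q q
single-exception em {A} Q a unique with em {Σ A λ x → ¬ Q x}
... | yes (i , ¬Qi) = i , λ q i≢q →
        decidable-stable em λ ¬Qq → i≢q (unique i q ¬Qi ¬Qq)
... | no noFailure  = a , λ q _ →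
        decidable-stable em λ ¬Qq → noFailure (q , ¬Qq)

module _ (P : Pole) where
  open Pole P
  open Realizability P

  -- t is orthogonal to the set of stacks S: t ⋆ σ ∈ ⊥⊥ for all σ ∈ S,
  -- i.e. t realizes the constant formula S.
  Orthogonal : Pred Stack 0ℓ → Term → Set
  Orthogonal S t = ∀ σ → S σ → ⊥⊥ (t ⋆ σ)

  arrows-elim : ∀ {n} m (D : Fin m → Formula n) (A : Formula n) (ρ : Env n) ts π →
    ‖ arrows m D A ‖⟨ ρ ⟩ (pushAll m ts π) →
    (∀ j → ∣ D j ∣⟨ ρ ⟩ (ts j)) × ‖ A ‖⟨ ρ ⟩ π
  arrows-elim zero    D A ρ ts π h = (λ ()) , h
  arrows-elim (suc m) D A ρ ts π (_ , _ , refl , realizes₀ , rest)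
    with arrows-elim m (λ j → D (suc j)) A ρ (λ j → ts (suc j)) π rest
  ... | realizesₛ , falsifiesA = realizes , falsifiesA
    where
    realizes : ∀ j → ∣ D j ∣⟨ ρ ⟩ (ts j)
    realizes zero    = realizes₀
    realizes (suc j) = realizesₛ j

  arrows-intro : ∀ {n} m (D : Fin m → Formula n) (A : Formula n) (ρ : Env n) ts π →
    (∀ j → ∣ D j ∣⟨ ρ ⟩ (ts j)) → ‖ A ‖⟨ ρ ⟩ π →
    ‖ arrows m D A ‖⟨ ρ ⟩ (pushAll m ts π)
  arrows-intro zero    D A ρ ts π realizes falsifiesA = falsifiesA
  arrows-intro (suc m) D A ρ ts π realizes falsifiesA =
    ts zero , _ , refl , realizes zero ,
    arrows-intro m (λ j → D (suc j)) A ρ (λ j → ts (suc j)) π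
      (λ j → realizes (suc j)) falsifiesA

  ⋂-elim : ∀ {n} m (F : Fin m → Formula n) (ρ : Env n) σ →
    ‖ ⋂ m F ‖⟨ ρ ⟩ σ → Σ (Fin m) λ i → ‖ F i ‖⟨ ρ ⟩ σ
  ⋂-elim zero          F ρ σ (lift ())
  ⋂-elim (suc zero)    F ρ σ h        = zero , h
  ⋂-elim (suc (suc m)) F ρ σ (inj₁ h) = zero , h
  ⋂-elim (suc (suc m)) F ρ σ (inj₂ h) with ⋂-elim (suc m) (λ j → F (suc j)) ρ σ h
  ... | i , hᵢ = suc i , hᵢ

  ⋂-intro : ∀ {n} m (F : Fin (suc m) → Formula n) (ρ : Env n) σ i →
    ‖ F i ‖⟨ ρ ⟩ σ → ‖ ⋂ (suc m) F ‖⟨ ρ ⟩ σ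
  ⋂-intro zero    F ρ σ zero    h = h
  ⋂-intro (suc m) F ρ σ zero    h = inj₁ h
  ⋂-intro (suc m) F ρ σ (suc i) h = inj₂ (⋂-intro m (λ j → F (suc j)) ρ σ i h)

  C-elim : ∀ n (i j : Fin n) (S : Pred Stack 0ℓ) (ρ : Env 0) t →
    i ≢ j → ∣ C n i j ∣⟨ S ∷ₑ ρ ⟩ t → Orthogonal S t
  C-elim n i j S ρ t i≢j realizes with i ≟ j
  ... | yes i≡j = ⊥-elim (i≢j i≡j)
  ... | no  _   = λ σ σ∈S → realizes σ (lift σ∈S)

  C-intro : ∀ n (i j : Fin n) (S : Pred Stack 0ℓ) (ρ : Env 0) t →
    (i ≢ j → Orthogonal S t) → ∣ C n i j ∣⟨ S ∷ₑ ρ ⟩ t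
  C-intro n i j S ρ t orth with i ≟ j
  ... | yes _   = λ σ ()
  ... | no  i≢j = λ σ σ∈S → orth i≢j σ (lower σ∈S)

  B-elim : ∀ n i (S : Pred Stack 0ℓ) (ρ : Env 0) ts π →
    ‖ B n i ‖⟨ S ∷ₑ ρ ⟩ (pushAll n ts π) →
    S π × (∀ j → i ≢ j → Orthogonal S (ts j))
  B-elim n i S ρ ts π h with arrows-elim n (C n i) (`var zero) (S ∷ₑ ρ) ts π h
  ... | realizes , lift π∈S =
        π∈S , λ j i≢j → C-elim n i j S ρ (ts j) i≢j (realizes j)

  B-intro : ∀ n i (S : Pred Stack 0ℓ) (ρ : Env 0) ts π →
    S π → (∀ j → i ≢ j → Orthogonal S (ts j)) →
    ‖ B n i ‖⟨ S ∷ₑ ρ ⟩ (pushAll n ts π)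
  B-intro n i S ρ ts π π∈S orth =
    arrows-intro n (C n i) (`var zero) (S ∷ₑ ρ) ts π
      (λ j → C-intro n i j S ρ (ts j) (orth j)) (lift π∈S)

  -- "Only if": a falsity witness (S, i) for Nₙ forces every index whose
  -- process leaves the pole to be i, because π ∈ S.
  N-at-most-one-failure : ∀ n (ts : Fin n → Term) π →
    ‖ N n ‖ (pushAll n ts π) →
    ∀ (i j : Fin n) → ¬ ⊥⊥ (ts i ⋆ π) → ¬ ⊥⊥ (ts j ⋆ π) → i ≡ j
  N-at-most-one-failure n ts π (S , h) i j ¬⊥⊥ᵢ ¬⊥⊥ⱼ =
    trans (sym (is-exception i ¬⊥⊥ᵢ)) (is-exception j ¬⊥⊥ⱼ)
    where
    exception : Fin n
    exception = proj₁ (⋂-elim n (B n) (S ∷ₑ _) _ h)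

    falsifies-B : S π × (∀ j → exception ≢ j → Orthogonal S (ts j))
    falsifies-B = B-elim n exception S _ ts π (proj₂ (⋂-elim n (B n) (S ∷ₑ _) _ h))

    is-exception : ∀ q → ¬ ⊥⊥ (ts q ⋆ π) → exception ≡ q
    is-exception q ¬⊥⊥q with exception ≟ q
    ... | yes e  = e
    ... | no  ne = ⊥-elim (¬⊥⊥q (proj₂ falsifies-B q ne π (proj₁ falsifies-B)))

  -- "If": with the exceptional index i, the witness S = {π} falsifies Bᵢ.
  N-from-exception : ∀ n (ts : Fin (suc n) → Term) π (i : Fin (suc n)) →
    (∀ q → i ≢ q → ⊥⊥ (ts q ⋆ π)) →
    ‖ N (suc n) ‖ (pushAll (suc n) ts π)
  N-from-exception n ts π i others =
    S , ⋂-intro n (B (suc n)) (S ∷ₑ _) _ i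
          (B-intro (suc n) i S _ ts π refl orth)
    where
    S : Pred Stack 0ℓ
    S σ = σ ≡ π

    orth : ∀ q → i ≢ q → Orthogonal S (ts q)
    orth q i≢q .π refl = others q i≢q

mainTheorem10 : ExcludedMiddle 0ℓ →
  (n : ℕ) → 1 ≤ n → (P : Pole) → (ts : Fin n → Term) → (π : Stack) →
  let open Pole P
      open Realizability P
  in (‖ N n ‖ (pushAll n ts π) →
        ∀ (i j : Fin n) → ¬ ⊥⊥ (ts i ⋆ π) → ¬ ⊥⊥ (ts j ⋆ π) → i ≡ j)
   × ((∀ (i j : Fin n) → ¬ ⊥⊥ (ts i ⋆ π) → ¬ ⊥⊥ (ts j ⋆ π) → i ≡ j) →
        ‖ N n ‖ (pushAll n ts π))
mainTheorem10 em (suc n) (s≤s _) P ts π =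
  N-at-most-one-failure P (suc n) ts π ,
  λ unique →
    let open Pole P
        (i , others) = single-exception em (λ q → ⊥⊥ (ts q ⋆ π)) zero unique
    in N-from-exception P n ts π i others
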